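{- The map $F\mapsto\mathbf c(F)$ is a bijection between the set of all indexed forests and the set of $\mathbb{N}$-vectors $(c_i)_{i\in\mathbb{Z}}$. It restricts to a bijection between indexed forests with support in $\mathbb{Z}_{\ge1}$ and $\mathbb{N}$-vectors with support in $\mathbb{Z}_{\ge1}$.
   Context: An $\mathbb{N}$-vector is a sequence $(c_i)_{i\in\mathbb{Z}}$ of nonnegative integers with finitely many nonzero entries; its support is $\{i:c_i>0\}$. Indexed forests: for finite $S\subset\mathbb{Z}$ with maximal consecutive blocks $I_1<\cdots<I_k$, an indexed forest $F$ with support $S$ is a tuple of plane binary trees $T_1,\dots,T_k$, $T_j$ having $|I_j|$ nodes canonically labeled by $I_j$ in inorder. For a node $v$, $\rho_F(v)$ is the canonical label of the node reached from $v$ by following left children as long as possible. Then $\mathbf c(F)=(c_i)_{i\in\mathbb{Z}}$ with $c_i=\#\{v:\rho_F(v)=i\}$. -}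

module Defs where

open import Data.Nat as ℕ using (ℕ; zero; suc)
open import Data.Integer as ℤ using (ℤ; +_; ∣_∣)
open import Data.List using (List; []; _∷_; _++_; length; filter; concatMap)
open import Data.List.Relation.Unary.Any using (Any)
open import Data.Product using (Σ; ∃; _×_; _,_; proj₁)
open import Data.Unit using (⊤)
open import Relation.Binary.PropositionalEquality using (_≡_)

-- Plane binary trees; `leaf` is the empty tree (no node), `node l r` is a
-- node with (possibly empty) left subtree l and right subtree r.
data Tree : Set where
  leaf : Tree
  node : Tree → Tree → Tree

size : Tree → ℕ
size leaf       = 0
size (node l r) = suc (size l ℕ.+ size r)

-- A block: (a , T) means the tree T whose nodes are canonically labeled in
-- inorder by the consecutive integers a, a+1, ..., a + size T - 1.
Block : Set
Block = ℤ × Tree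

-- consecutive blocks are separated by a gap (so blocks are exactly the
-- maximal consecutive runs of the support), in increasing order
Gap : Block → List Block → Set
Gap b [] = ⊤
Gap (a , T) ((b , U) ∷ _) = a ℤ.+ + size T ℤ.< b

WF : List Block → Set
WF [] = ⊤
WF ((a , T) ∷ bs) = (0 ℕ.< size T) × Gap (a , T) bs × WF bs

IndexedForest : Set
IndexedForest = Σ (List Block) WF

blocks : IndexedForest → List Block
blocks = proj₁

_∈supp_ : ℤ → IndexedForest → Set
i ∈supp F = Any (λ { (a , T) → (a ℤ.≤ i) × (i ℤ.< a ℤ.+ + size T) }) (blocks F)

-- ρ of a node, where the node's subtree is `node l r` with its inorder labels
-- starting at offset a: follow left children as long as possible and return
-- the canonical label (inorder) of the node reached.
-- The label of the root of (node l r) at offset a is a + size l.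
ρroot : ℤ → Tree → Tree → ℤ
ρroot a leaf r = a ℤ.+ + size leaf
ρroot a (node ll lr) r = ρroot a ll lr

ρs : ℤ → Tree → List ℤ
ρs a leaf = []
ρs a (node l r) = ρroot a l r ∷ (ρs a l ++ ρs (a ℤ.+ + suc (size l)) r)

ρsForest : IndexedForest → List ℤ
ρsForest F = concatMap (λ { (a , T) → ρs a T }) (blocks F)

c : IndexedForest → ℤ → ℕ
c F i = length (filter (λ j → j ℤ.≟ i) (ρsForest F))

FinSupp : (ℤ → ℕ) → Set
FinSupp v = ∃ λ (N : ℕ) → ∀ (i : ℤ) → N ℕ.< ∣ i ∣ → v i ≡ 0

NVec : Set
NVec = Σ (ℤ → ℕ) FinSupp

ForestSuppPos : IndexedForest → Set
ForestSuppPos F = ∀ i → i ∈supp F → + 1 ℤ.≤ i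

VecSuppPos : (ℤ → ℕ) → Set
VecSuppPos v = ∀ i → 0 ℕ.< v i → + 1 ℤ.≤ i

-- Since ρ of a root is the first label of its tree, the vector of counts of a tree
-- (its profile) is that of its left subtree with the first entry raised by one, then
-- 0 for the root, then the profile of the right subtree; so a tree is recovered from its
-- profile. Reading a forest from any b below its support as a row of possibly empty
-- trees separated by single unused labels, c(F) is the concatenation of the profiles
-- with a 0 for each gap. This row is determined by c(F) up to trailing empty trees, and
-- every list of naturals is such a concatenation up to trailing zeros (an entry x > 0 is
-- prepended by a new leftmost node made a left child x − 1 times, an entry 0 by a new
-- empty tree), which gives the bijection.
-- For the support: ρ(v) lies in the block of v, and the first label of a block is hit.

module Submission where

open import Defs
open import Data.Integer using (ℤ)
open import Data.Product using (Σ; ∃; _×_; _,_; proj₁)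
open import Function using (_⇔_)
open import Relation.Binary.PropositionalEquality using (_≡_)

open import Data.Nat as ℕ using (ℕ; zero; suc; z≤n; s≤s)
import Data.Nat.Properties as ℕP
open import Data.Integer as ℤ using (+_; -[1+_]; ∣_∣; _⊓_)
import Data.Integer.Properties as ℤP
open import Data.List using (List; []; _∷_; _++_; length; filter; replicate; foldr)
import Data.List.Properties as LP
open import Data.List.Relation.Unary.Any using (here; there)
open import Data.Product using (proj₂)
open import Data.Unit using (⊤; tt)
open import Data.Empty using (⊥; ⊥-elim)
open import Function using (_∘_; mk⇔)
open import Relation.Nullary using (yes; no)
open import Relation.Binary.PropositionalEquality
  using (refl; sym; trans; cong; cong₂; subst; subst₂; module ≡-Reasoning)

infixl 6 _⊕_
_⊕_ : ℤ → ℕ → ℤ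
a ⊕ n = a ℤ.+ + n

⊕-identityʳ : ∀ a → a ⊕ 0 ≡ a
⊕-identityʳ = ℤP.+-identityʳ

⊕-+ : ∀ a m n → a ⊕ (m ℕ.+ n) ≡ a ⊕ m ⊕ n
⊕-+ a m n = trans (cong (λ k → a ℤ.+ k) (ℤP.pos-+ m n)) (sym (ℤP.+-assoc a (+ m) (+ n)))

⊕-suc : ∀ a n → a ⊕ suc n ≡ a ⊕ 1 ⊕ n
⊕-suc a = ⊕-+ a 1

⊕-sucʳ : ∀ a n → a ⊕ suc n ≡ a ⊕ n ⊕ 1
⊕-sucʳ a n = trans (cong (a ⊕_) (ℕP.+-comm 1 n)) (⊕-+ a n 1)

⊕1≡suc : ∀ a → a ⊕ 1 ≡ ℤ.suc a
⊕1≡suc a = ℤP.+-comm a (+ 1)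

≤-⊕ : ∀ a n → a ℤ.≤ a ⊕ n
≤-⊕ a n = subst (ℤ._≤ a ⊕ n) (⊕-identityʳ a) (ℤP.+-monoʳ-≤ a (ℤ.+≤+ z≤n))

<-⊕-suc : ∀ a n → a ℤ.< a ⊕ suc n
<-⊕-suc a n = subst (ℤ._< a ⊕ suc n) (⊕-identityʳ a) (ℤP.+-monoʳ-< a (ℤ.+<+ (s≤s z≤n)))

<⇒⊕1≤ : ∀ {i j} → i ℤ.< j → i ⊕ 1 ℤ.≤ j
<⇒⊕1≤ {i} p = subst (ℤ._≤ _) (sym (⊕1≡suc i)) (ℤP.i<j⇒suc[i]≤j p)

⊕1≤⇒< : ∀ {i j} → i ⊕ 1 ℤ.≤ j → i ℤ.< j
⊕1≤⇒< {i} p = ℤP.suc[i]≤j⇒i<j (subst (ℤ._≤ _) (⊕1≡suc i) p)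

<⊕1⇒≤ : ∀ {i j} → i ℤ.< j ⊕ 1 → i ℤ.≤ j
<⊕1⇒≤ {i} {j} p = subst₂ ℤ._≤_ (ℤP.pred-suc i) (ℤP.pred-suc j)
  (ℤP.pred-mono (ℤP.i<j⇒suc[i]≤j (subst (i ℤ.<_) (⊕1≡suc j) p)))

≤⇒≡⊕ : ∀ {b a} → b ℤ.≤ a → ∃ λ d → a ≡ b ⊕ d
≤⇒≡⊕ {b} {a} b≤a = ∣ a ℤ.- b ∣ , (begin
  a                    ≡⟨ ℤP.+-identityˡ a ⟨
  ℤ.0ℤ ℤ.+ a           ≡⟨ cong (ℤ._+ a) (ℤP.+-inverseʳ b) ⟨
  b ℤ.- b ℤ.+ a        ≡⟨ ℤP.+-assoc b (ℤ.- b) a ⟩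
  b ℤ.+ (ℤ.- b ℤ.+ a)  ≡⟨ cong (λ k → b ℤ.+ k) (ℤP.+-comm (ℤ.- b) a) ⟩
  b ℤ.+ (a ℤ.- b)      ≡⟨ cong (λ k → b ℤ.+ k) (ℤP.0≤i⇒+∣i∣≡i (ℤP.i≤j⇒0≤j-i b≤a)) ⟨
  b ⊕ ∣ a ℤ.- b ∣      ∎)
  where open ≡-Reasoning

δ : ℤ → ℤ → ℕ
δ a i with a ℤ.≟ i
... | yes _ = 1
... | no _ = 0

δ-refl : ∀ a → δ a a ≡ 1
δ-refl a with a ℤ.≟ a
... | yes _ = refl
... | no a≢a = ⊥-elim (a≢a refl)

vecFrom : ℤ → List ℕ → ℤ → ℕ
vecFrom a [] i = 0
vecFrom a (x ∷ xs) i with a ℤ.≟ i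
... | yes _ = x
... | no _ = vecFrom (a ⊕ 1) xs i

vecFrom-head : ∀ a x xs → vecFrom a (x ∷ xs) a ≡ x
vecFrom-head a x xs with a ℤ.≟ a
... | yes _ = refl
... | no a≢a = ⊥-elim (a≢a refl)

vecFrom-< : ∀ a xs {i} → i ℤ.< a → vecFrom a xs i ≡ 0
vecFrom-< a [] i<a = refl
vecFrom-< a (x ∷ xs) {i} i<a with a ℤ.≟ i
... | yes refl = ⊥-elim (ℤP.<-irrefl refl i<a)
... | no _ = vecFrom-< (a ⊕ 1) xs (ℤP.<-≤-trans i<a (≤-⊕ a 1))

vecFrom-≥ : ∀ a xs {i} → a ⊕ length xs ℤ.≤ i → vecFrom a xs i ≡ 0
vecFrom-≥ a [] _ = refl
vecFrom-≥ a (x ∷ xs) {i} end≤i with a ℤ.≟ i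
... | yes refl = ⊥-elim (ℤP.<-irrefl refl (ℤP.<-≤-trans (<-⊕-suc a (length xs)) end≤i))
... | no _ = vecFrom-≥ (a ⊕ 1) xs (subst (ℤ._≤ i) (⊕-suc a (length xs)) end≤i)

vecFrom-support : ∀ a xs {i} → 0 ℕ.< vecFrom a xs i → (a ℤ.≤ i) × (i ℤ.< a ⊕ length xs)
vecFrom-support a xs {i} pos with i ℤ.<? a | i ℤ.<? a ⊕ length xs
... | yes i<a | _ = ⊥-elim (ℕP.<-irrefl (sym (vecFrom-< a xs i<a)) pos)
... | no _ | no i≮end = ⊥-elim (ℕP.<-irrefl (sym (vecFrom-≥ a xs (ℤP.≮⇒≥ i≮end))) pos)
... | no i≮a | yes i<end = ℤP.≮⇒≥ i≮a , i<end

vecFrom-finiteSupport : ∀ a xs → FinSupp (vecFrom a xs)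
vecFrom-finiteSupport a [] = 0 , λ _ _ → refl
vecFrom-finiteSupport a (x ∷ xs) with vecFrom-finiteSupport (a ⊕ 1) xs
... | N , vanish = ∣ a ∣ ℕ.⊔ N , bound
  where
  bound : ∀ i → ∣ a ∣ ℕ.⊔ N ℕ.< ∣ i ∣ → vecFrom a (x ∷ xs) i ≡ 0
  bound i p with a ℤ.≟ i
  ... | yes refl = ⊥-elim (ℕP.<-irrefl refl (ℕP.≤-<-trans (ℕP.m≤m⊔n ∣ a ∣ N) p))
  ... | no _ = vanish i (ℕP.≤-<-trans (ℕP.m≤n⊔m ∣ a ∣ N) p)

vecFrom-++ : ∀ a xs ys i → vecFrom a (xs ++ ys) i ≡ vecFrom a xs i ℕ.+ vecFrom (a ⊕ length xs) ys i
vecFrom-++ a [] ys i = cong (λ b → vecFrom b ys i) (sym (⊕-identityʳ a))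
vecFrom-++ a (x ∷ xs) ys i with a ℤ.≟ i
... | yes refl = sym (trans (cong (x ℕ.+_) (vecFrom-< _ ys (<-⊕-suc a (length xs)))) (ℕP.+-identityʳ x))
... | no _ = trans (vecFrom-++ (a ⊕ 1) xs ys i)
  (cong (λ b → vecFrom (a ⊕ 1) xs i ℕ.+ vecFrom b ys i) (sym (⊕-suc a (length xs))))

vecFrom-0∷ : ∀ a xs i → vecFrom a (0 ∷ xs) i ≡ vecFrom (a ⊕ 1) xs i
vecFrom-0∷ a xs i with a ℤ.≟ i
... | yes refl = sym (vecFrom-< (a ⊕ 1) xs (<-⊕-suc a 0))
... | no _ = refl

vecFrom-++-0∷ : ∀ a xs ys i →
  vecFrom a (xs ++ 0 ∷ ys) i ≡ vecFrom a xs i ℕ.+ vecFrom (a ⊕ suc (length xs)) ys i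
vecFrom-++-0∷ a xs ys i = trans (vecFrom-++ a xs (0 ∷ ys) i)
  (cong (vecFrom a xs i ℕ.+_) (trans (vecFrom-0∷ (a ⊕ length xs) ys i)
    (cong (λ b → vecFrom b ys i) (sym (⊕-sucʳ a (length xs))))))

zeros : ℕ → List ℕ
zeros k = replicate k 0

zeros-++ : ∀ j k → zeros j ++ zeros k ≡ zeros (j ℕ.+ k)
zeros-++ zero k = refl
zeros-++ (suc j) k = cong (0 ∷_) (zeros-++ j k)

vecFrom-zeros : ∀ a k i → vecFrom a (zeros k) i ≡ 0
vecFrom-zeros a zero i = refl
vecFrom-zeros a (suc k) i = trans (vecFrom-0∷ a (zeros k) i) (vecFrom-zeros (a ⊕ 1) k i)

vecFrom-++-zeros : ∀ a xs k i → vecFrom a (xs ++ zeros k) i ≡ vecFrom a xs i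
vecFrom-++-zeros a xs k i = trans (vecFrom-++ a xs (zeros k) i)
  (trans (cong (vecFrom a xs i ℕ.+_) (vecFrom-zeros _ k i)) (ℕP.+-identityʳ _))

vecFrom-injective : ∀ a xs ys → length xs ≡ length ys →
  (∀ i → vecFrom a xs i ≡ vecFrom a ys i) → xs ≡ ys
vecFrom-injective a [] [] _ _ = refl
vecFrom-injective a (x ∷ xs) (y ∷ ys) len eq = cong₂ _∷_ heads
  (vecFrom-injective (a ⊕ 1) xs ys (ℕP.suc-injective len) tails)
  where
  heads : x ≡ y
  heads = trans (sym (vecFrom-head a x xs)) (trans (eq a) (vecFrom-head a y ys))
  tails : ∀ i → vecFrom (a ⊕ 1) xs i ≡ vecFrom (a ⊕ 1) ys i
  tails i with a ℤ.≟ i | eq i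
  ... | yes refl | _ = trans (vecFrom-< _ xs (<-⊕-suc a 0)) (sym (vecFrom-< _ ys (<-⊕-suc a 0)))
  ... | no _ | eqᵢ = eqᵢ

vecFrom-injective-upToZeros : ∀ a xs ys → (∀ i → vecFrom a xs i ≡ vecFrom a ys i) →
  xs ++ zeros (length ys) ≡ ys ++ zeros (length xs)
vecFrom-injective-upToZeros a xs ys eq = vecFrom-injective a _ _ equalLength
  (λ i → trans (vecFrom-++-zeros a xs _ i) (trans (eq i) (sym (vecFrom-++-zeros a ys _ i))))
  where
  length-padded : ∀ us vs → length (us ++ zeros (length vs)) ≡ length us ℕ.+ length vs
  length-padded us vs = trans (LP.length-++ us) (cong (length us ℕ.+_) (LP.length-replicate (length vs)))
  equalLength : length (xs ++ zeros (length ys)) ≡ length (ys ++ zeros (length xs))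
  equalLength = trans (length-padded xs ys) (trans (ℕP.+-comm (length xs) _) (sym (length-padded ys xs)))

window : (ℤ → ℕ) → ℤ → ℕ → List ℕ
window v b zero = []
window v b (suc n) = v b ∷ window v (b ⊕ 1) n

vecFrom-window : ∀ v b n i → (i ℤ.< b → v i ≡ 0) → (b ⊕ n ℤ.≤ i → v i ≡ 0) →
  vecFrom b (window v b n) i ≡ v i
vecFrom-window v b zero i below above with i ℤ.<? b
... | yes i<b = sym (below i<b)
... | no i≮b = sym (above (subst (ℤ._≤ i) (sym (⊕-identityʳ b)) (ℤP.≮⇒≥ i≮b)))
vecFrom-window v b (suc n) i below above with b ℤ.≟ i
... | yes refl = refl
... | no b≢i = vecFrom-window v (b ⊕ 1) n i
  (λ i<b+1 → below (ℤP.≤∧≢⇒< (<⊕1⇒≤ i<b+1) (b≢i ∘ sym)))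
  (above ∘ subst (ℤ._≤ i) (sym (⊕-suc b n)))

occurrences : List ℤ → ℤ → ℕ
occurrences L i = length (filter (λ j → j ℤ.≟ i) L)

occurrences-∷ : ∀ j L i → occurrences (j ∷ L) i ≡ δ j i ℕ.+ occurrences L i
occurrences-∷ j L i with j ℤ.≟ i
... | yes _ = refl
... | no _ = refl

occurrences-++ : ∀ L M i → occurrences (L ++ M) i ≡ occurrences L i ℕ.+ occurrences M i
occurrences-++ L M i = trans (cong length (LP.filter-++ (λ j → j ℤ.≟ i) L M)) (LP.length-++ (filter (λ j → j ℤ.≟ i) L))

incHead : List ℕ → List ℕ
incHead [] = []
incHead (x ∷ xs) = suc x ∷ xs

length-incHead : ∀ xs → length (incHead xs) ≡ length xs
length-incHead [] = refl
length-incHead (x ∷ xs) = refl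

incHead-injective : ∀ xs ys → incHead xs ≡ incHead ys → xs ≡ ys
incHead-injective [] [] _ = refl
incHead-injective (x ∷ xs) (y ∷ ys) refl = refl

incHead-++ : ∀ xs y ys zs → incHead (xs ++ y ∷ ys) ++ zs ≡ incHead (xs ++ y ∷ ys ++ zs)
incHead-++ [] y ys zs = refl
incHead-++ (x ∷ xs) y ys zs = cong (suc x ∷_) (LP.++-assoc xs (y ∷ ys) zs)

vecFrom-suc∷ : ∀ a x xs i → vecFrom a (suc x ∷ xs) i ≡ δ a i ℕ.+ vecFrom a (x ∷ xs) i
vecFrom-suc∷ a x xs i with a ℤ.≟ i
... | yes _ = refl
... | no _ = refl

vecFrom-incHead : ∀ a xs y ys i →
  vecFrom a (incHead (xs ++ y ∷ ys)) i ≡ δ a i ℕ.+ vecFrom a (xs ++ y ∷ ys) i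
vecFrom-incHead a [] y ys i = vecFrom-suc∷ a y ys i
vecFrom-incHead a (x ∷ xs) y ys i = vecFrom-suc∷ a x (xs ++ y ∷ ys) i

-- Entry k of profile T counts the nodes v of T with ρ(v) equal to the k-th label.
profile : Tree → List ℕ
profile leaf = []
profile (node l r) = incHead (profile l ++ 0 ∷ profile r)

length-profile : ∀ T → length (profile T) ≡ size T
length-profile leaf = refl
length-profile (node l r) = begin
  length (incHead (profile l ++ 0 ∷ profile r))  ≡⟨ length-incHead (profile l ++ 0 ∷ profile r) ⟩
  length (profile l ++ 0 ∷ profile r)            ≡⟨ LP.length-++ (profile l) ⟩
  length (profile l) ℕ.+ suc (length (profile r)) ≡⟨ cong₂ (λ m n → m ℕ.+ suc n) (length-profile l) (length-profile r) ⟩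
  size l ℕ.+ suc (size r)                         ≡⟨ ℕP.+-suc (size l) (size r) ⟩
  size (node l r)                                 ∎
  where open ≡-Reasoning

vecFrom-profile-0∷ : ∀ a T ys i →
  vecFrom a (profile T ++ 0 ∷ ys) i ≡ vecFrom a (profile T) i ℕ.+ vecFrom (a ⊕ suc (size T)) ys i
vecFrom-profile-0∷ a T ys i = trans (vecFrom-++-0∷ a (profile T) ys i)
  (cong (λ n → vecFrom a (profile T) i ℕ.+ vecFrom (a ⊕ suc n) ys i) (length-profile T))

ρroot≡start : ∀ a l r → ρroot a l r ≡ a
ρroot≡start a leaf r = ⊕-identityʳ a
ρroot≡start a (node ll lr) r = ρroot≡start a ll lr

occurrences-ρs : ∀ a T i → occurrences (ρs a T) i ≡ vecFrom a (profile T) i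
occurrences-ρs a leaf i = refl
occurrences-ρs a (node l r) i = begin
  occurrences (ρroot a l r ∷ ρs a l ++ ρs a′ r) i
    ≡⟨ occurrences-∷ (ρroot a l r) _ i ⟩
  δ (ρroot a l r) i ℕ.+ occurrences (ρs a l ++ ρs a′ r) i
    ≡⟨ cong₂ ℕ._+_ (cong (λ b → δ b i) (ρroot≡start a l r)) (occurrences-++ (ρs a l) _ i) ⟩
  δ a i ℕ.+ (occurrences (ρs a l) i ℕ.+ occurrences (ρs a′ r) i)
    ≡⟨ cong (δ a i ℕ.+_) (cong₂ ℕ._+_ (occurrences-ρs a l i) (occurrences-ρs a′ r i)) ⟩
  δ a i ℕ.+ (vecFrom a (profile l) i ℕ.+ vecFrom a′ (profile r) i)
    ≡⟨ cong (δ a i ℕ.+_) (vecFrom-profile-0∷ a l (profile r) i) ⟨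
  δ a i ℕ.+ vecFrom a (profile l ++ 0 ∷ profile r) i
    ≡⟨ vecFrom-incHead a (profile l) 0 (profile r) i ⟨
  vecFrom a (profile (node l r)) i ∎
  where
  open ≡-Reasoning
  a′ = a ⊕ suc (size l)

StartsWithZero : List ℕ → Set
StartsWithZero [] = ⊤
StartsWithZero (zero ∷ _) = ⊤
StartsWithZero (suc _ ∷ _) = ⊥

incHead-¬StartsWithZero : ∀ xs y ys → StartsWithZero (incHead (xs ++ y ∷ ys)) → ⊥
incHead-¬StartsWithZero [] y ys ()
incHead-¬StartsWithZero (x ∷ xs) y ys ()

profile-++-injective : ∀ T U {Z Z′} → StartsWithZero Z → StartsWithZero Z′ →
  profile T ++ Z ≡ profile U ++ Z′ → (T ≡ U) × (Z ≡ Z′)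
profile-++-injective leaf leaf _ _ eq = refl , eq
profile-++-injective leaf (node l r) {Z′ = Z′} z _ eq =
  ⊥-elim (incHead-¬StartsWithZero (profile l) 0 (profile r ++ Z′)
    (subst StartsWithZero (trans eq (incHead-++ (profile l) 0 (profile r) Z′)) z))
profile-++-injective (node l r) leaf {Z} _ z′ eq =
  ⊥-elim (incHead-¬StartsWithZero (profile l) 0 (profile r ++ Z)
    (subst StartsWithZero (trans (sym eq) (incHead-++ (profile l) 0 (profile r) Z)) z′))
profile-++-injective (node l r) (node l′ r′) {Z} {Z′} z z′ eq
  with profile-++-injective l l′ tt tt (incHead-injective _ _
         (trans (sym (incHead-++ (profile l) 0 (profile r) Z)) (trans eq (incHead-++ (profile l′) 0 (profile r′) Z′))))
... | refl , rest with profile-++-injective r r′ z z′ (LP.∷-injectiveʳ rest)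
... | refl , refl = refl , refl

-- A chain T₀ ∷ … ∷ [ Tₖ ] placed at b lays out possibly empty trees from label b on,
-- leaving one unused label between consecutive trees.
data Chain : Set where
  [_] : Tree → Chain
  _∷_ : Tree → Chain → Chain

layout : Chain → List ℕ
layout [ T ] = profile T
layout (T ∷ S) = profile T ++ 0 ∷ layout S

consBlock : ℤ → Tree → List Block → List Block
consBlock b leaf bs = bs
consBlock b (node l r) bs = (b , node l r) ∷ bs

chainBlocks : ℤ → Chain → List Block
chainBlocks b [ T ] = consBlock b T []
chainBlocks b (T ∷ S) = consBlock b T (chainBlocks (b ⊕ suc (size T)) S)

_≤head_ : ℤ → List Block → Set
b ≤head [] = ⊤
b ≤head ((a , _) ∷ _) = b ℤ.≤ a

≤head-trans : ∀ {b b′} bs → b′ ℤ.≤ b → b ≤head bs → b′ ≤head bs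
≤head-trans [] _ _ = tt
≤head-trans (_ ∷ _) b′≤b b≤a = ℤP.≤-trans b′≤b b≤a

Gap⇒≤head : ∀ a T bs → Gap (a , T) bs → (a ⊕ suc (size T)) ≤head bs
Gap⇒≤head a T [] _ = tt
Gap⇒≤head a T (_ ∷ _) gap = subst (ℤ._≤ _) (sym (⊕-sucʳ a (size T))) (<⇒⊕1≤ gap)

≤head⇒Gap : ∀ a T bs → (a ⊕ suc (size T)) ≤head bs → Gap (a , T) bs
≤head⇒Gap a T [] _ = tt
≤head⇒Gap a T (_ ∷ _) p = ⊕1≤⇒< (subst (ℤ._≤ _) (⊕-sucʳ a (size T)) p)

WF-consBlock : ∀ b T bs → WF bs → (b ⊕ suc (size T)) ≤head bs →
  WF (consBlock b T bs) × b ≤head consBlock b T bs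
WF-consBlock b leaf bs w p = w , ≤head-trans bs (≤-⊕ b 1) p
WF-consBlock b (node l r) bs w p = (s≤s z≤n , ≤head⇒Gap b (node l r) bs p , w) , ℤP.≤-refl

WF-chainBlocks : ∀ b S → WF (chainBlocks b S) × b ≤head chainBlocks b S
WF-chainBlocks b [ T ] = WF-consBlock b T [] tt tt
WF-chainBlocks b (T ∷ S) =
  let w , p = WF-chainBlocks (b ⊕ suc (size T)) S in WF-consBlock b T _ w p

forestOf : ℤ → Chain → IndexedForest
forestOf b S = chainBlocks b S , proj₁ (WF-chainBlocks b S)

blocksρs : List Block → List ℤ
blocksρs [] = []
blocksρs ((a , T) ∷ bs) = ρs a T ++ blocksρs bs

ρsForest≡blocksρs : ∀ bs (w : WF bs) → ρsForest (bs , w) ≡ blocksρs bs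
ρsForest≡blocksρs [] _ = refl
ρsForest≡blocksρs ((a , T) ∷ bs) (_ , _ , w) = cong (ρs a T ++_) (ρsForest≡blocksρs bs w)

occurrences-consBlock : ∀ b T bs i →
  occurrences (blocksρs (consBlock b T bs)) i ≡ occurrences (ρs b T) i ℕ.+ occurrences (blocksρs bs) i
occurrences-consBlock b leaf bs i = refl
occurrences-consBlock b (node l r) bs i = occurrences-++ (ρs b (node l r)) _ i

occurrences-chainBlocks : ∀ b S i → occurrences (blocksρs (chainBlocks b S)) i ≡ vecFrom b (layout S) i
occurrences-chainBlocks b [ T ] i = begin
  occurrences (blocksρs (consBlock b T [])) i  ≡⟨ occurrences-consBlock b T [] i ⟩
  occurrences (ρs b T) i ℕ.+ 0                 ≡⟨ ℕP.+-identityʳ _ ⟩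
  occurrences (ρs b T) i                       ≡⟨ occurrences-ρs b T i ⟩
  vecFrom b (profile T) i                      ∎
  where open ≡-Reasoning
occurrences-chainBlocks b (T ∷ S) i = begin
  occurrences (blocksρs (consBlock b T (chainBlocks b′ S))) i
    ≡⟨ occurrences-consBlock b T _ i ⟩
  occurrences (ρs b T) i ℕ.+ occurrences (blocksρs (chainBlocks b′ S)) i
    ≡⟨ cong₂ ℕ._+_ (occurrences-ρs b T i) (occurrences-chainBlocks b′ S i) ⟩
  vecFrom b (profile T) i ℕ.+ vecFrom b′ (layout S) i
    ≡⟨ vecFrom-profile-0∷ b T (layout S) i ⟨
  vecFrom b (layout (T ∷ S)) i ∎
  where
  open ≡-Reasoning
  b′ = b ⊕ suc (size T)

c-chain : ∀ F b S → chainBlocks b S ≡ blocks F → ∀ i → c F i ≡ vecFrom b (layout S) i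
c-chain (bs , w) b S refl i =
  trans (cong (λ L → occurrences L i) (ρsForest≡blocksρs bs w)) (occurrences-chainBlocks b S i)

leftPad : ℕ → Chain → Chain
leftPad zero S = S
leftPad (suc d) S = leaf ∷ leftPad d S

chainBlocks-leftPad : ∀ b d S → chainBlocks b (leftPad d S) ≡ chainBlocks (b ⊕ d) S
chainBlocks-leftPad b zero S = cong (λ a → chainBlocks a S) (sym (⊕-identityʳ b))
chainBlocks-leftPad b (suc d) S =
  trans (chainBlocks-leftPad (b ⊕ 1) d S) (cong (λ a → chainBlocks a S) (sym (⊕-suc b d)))

chainOf : ∀ b bs → WF bs → b ≤head bs → ∃ λ S → chainBlocks b S ≡ bs
chainOf b [] _ _ = [ leaf ] , refl
chainOf b ((a , leaf) ∷ bs) (() , _)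
chainOf b ((a , node l r) ∷ bs) (_ , gap , w) b≤a
  with ≤⇒≡⊕ b≤a | chainOf (a ⊕ suc (size (node l r))) bs w (Gap⇒≤head a (node l r) bs gap)
... | d , refl | S , eq =
  leftPad d (node l r ∷ S) , trans (chainBlocks-leftPad b d _) (cong ((b ⊕ d , node l r) ∷_) eq)

extend : ℕ → Chain → Chain
extend zero S = S
extend (suc k) [ T ] = T ∷ extend k [ leaf ]
extend (suc k) (T ∷ S) = T ∷ extend (suc k) S

layout-extend : ∀ k S → layout (extend k S) ≡ layout S ++ zeros k
layout-extend zero S = sym (LP.++-identityʳ (layout S))
layout-extend (suc k) [ T ] = cong (λ zs → profile T ++ 0 ∷ zs) (layout-extend k [ leaf ])
layout-extend (suc k) (T ∷ S) = trans (cong (λ zs → profile T ++ 0 ∷ zs) (layout-extend (suc k) S))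
  (sym (LP.++-assoc (profile T) (0 ∷ layout S) (zeros (suc k))))

chainBlocks-extend : ∀ b k S → chainBlocks b (extend k S) ≡ chainBlocks b S
chainBlocks-extend b zero S = refl
chainBlocks-extend b (suc k) [ T ] = cong (consBlock b T) (chainBlocks-extend _ k [ leaf ])
chainBlocks-extend b (suc k) (T ∷ S) = cong (consBlock b T) (chainBlocks-extend _ (suc k) S)

layout-injective : ∀ S S′ → layout S ≡ layout S′ → S ≡ S′
layout-injective [ T ] [ T′ ] eq
  with profile-++-injective T T′ tt tt (trans (LP.++-identityʳ _) (trans eq (sym (LP.++-identityʳ _))))
... | refl , _ = refl
layout-injective [ T ] (T′ ∷ S′) eq with profile-++-injective T T′ tt tt (trans (LP.++-identityʳ _) eq)
... | _ , ()
layout-injective (T ∷ S) [ T′ ] eq with profile-++-injective T T′ tt tt (trans eq (sym (LP.++-identityʳ _)))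
... | _ , ()
layout-injective (T ∷ S) (T′ ∷ S′) eq with profile-++-injective T T′ tt tt eq
... | refl , rest = cong (T ∷_) (layout-injective S S′ (LP.∷-injectiveʳ rest))

chainBlocks-resp-layout : ∀ b S S′ {m n} → layout S ++ zeros m ≡ layout S′ ++ zeros n →
  chainBlocks b S ≡ chainBlocks b S′
chainBlocks-resp-layout b S S′ {m} {n} eq = begin
  chainBlocks b S             ≡⟨ chainBlocks-extend b m S ⟨
  chainBlocks b (extend m S)  ≡⟨ cong (chainBlocks b) (layout-injective (extend m S) (extend n S′) extended-layouts) ⟩
  chainBlocks b (extend n S′) ≡⟨ chainBlocks-extend b n S′ ⟩
  chainBlocks b S′            ∎
  where
  open ≡-Reasoning
  extended-layouts : layout (extend m S) ≡ layout (extend n S′)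
  extended-layouts = trans (layout-extend m S) (trans eq (sym (layout-extend n S′)))

joinFirst : Chain → Chain
joinFirst [ T ] = [ node T leaf ]
joinFirst (T ∷ [ U ]) = [ node T U ]
joinFirst (T ∷ U ∷ S) = node T U ∷ S

layout-joinFirst : ∀ S → ∃ λ e → layout (joinFirst S) ≡ incHead (layout S ++ zeros e)
layout-joinFirst [ T ] = 1 , refl
layout-joinFirst (T ∷ [ U ]) = 0 , cong incHead (sym (LP.++-identityʳ (layout (T ∷ [ U ]))))
layout-joinFirst (T ∷ U ∷ S) = 0 , trans (incHead-++ (profile T) 0 (profile U) (0 ∷ layout S))
  (cong incHead (sym (LP.++-identityʳ (layout (T ∷ U ∷ S)))))

prepend : ℕ → Chain → Chain
prepend zero S = leaf ∷ S
prepend (suc zero) [ T ] = [ node leaf T ]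
prepend (suc zero) (T ∷ S) = node leaf T ∷ S
prepend (suc (suc k)) S = joinFirst (prepend (suc k) S)

layout-prepend : ∀ x S → ∃ λ j → layout (prepend x S) ≡ x ∷ layout S ++ zeros j
layout-prepend zero S = 0 , cong (0 ∷_) (sym (LP.++-identityʳ (layout S)))
layout-prepend (suc zero) [ T ] = 0 , cong (1 ∷_) (sym (LP.++-identityʳ (profile T)))
layout-prepend (suc zero) (T ∷ S) = 0 , cong (1 ∷_) (sym (LP.++-identityʳ (layout (T ∷ S))))
layout-prepend (suc (suc k)) S with layout-prepend (suc k) S | layout-joinFirst (prepend (suc k) S)
... | j , eq | e , eq′ = j ℕ.+ e , (begin
  layout (joinFirst (prepend (suc k) S))        ≡⟨ eq′ ⟩
  incHead (layout (prepend (suc k) S) ++ zeros e) ≡⟨ cong (λ xs → incHead (xs ++ zeros e)) eq ⟩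
  suc (suc k) ∷ (layout S ++ zeros j) ++ zeros e ≡⟨ cong (suc (suc k) ∷_) (LP.++-assoc (layout S) (zeros j) (zeros e)) ⟩
  suc (suc k) ∷ layout S ++ zeros j ++ zeros e   ≡⟨ cong (λ zs → suc (suc k) ∷ layout S ++ zs) (zeros-++ j e) ⟩
  suc (suc k) ∷ layout S ++ zeros (j ℕ.+ e)      ∎)
  where open ≡-Reasoning

fromList : List ℕ → Chain
fromList = foldr prepend [ leaf ]

layout-fromList : ∀ W → ∃ λ j → layout (fromList W) ≡ W ++ zeros j
layout-fromList [] = 0 , refl
layout-fromList (x ∷ W) with layout-fromList W | layout-prepend x (fromList W)
... | j , eq | j′ , eq′ = j ℕ.+ j′ , (begin
  layout (prepend x (fromList W))        ≡⟨ eq′ ⟩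
  x ∷ layout (fromList W) ++ zeros j′    ≡⟨ cong (λ xs → x ∷ xs ++ zeros j′) eq ⟩
  x ∷ (W ++ zeros j) ++ zeros j′         ≡⟨ cong (x ∷_) (LP.++-assoc W (zeros j) (zeros j′)) ⟩
  x ∷ W ++ zeros j ++ zeros j′           ≡⟨ cong (λ zs → x ∷ W ++ zs) (zeros-++ j j′) ⟩
  x ∷ W ++ zeros (j ℕ.+ j′)              ∎)
  where open ≡-Reasoning

firstStart : List Block → ℤ
firstStart [] = ℤ.0ℤ
firstStart ((a , _) ∷ _) = a

chainBelow : ∀ F {b} → b ℤ.≤ firstStart (blocks F) → ∃ λ S → chainBlocks b S ≡ blocks F
chainBelow ([] , w) p = chainOf _ [] w tt
chainBelow (bs@(_ ∷ _) , w) p = chainOf _ bs w p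

Gap-irrelevant : ∀ b bs (g g′ : Gap b bs) → g ≡ g′
Gap-irrelevant _ [] tt tt = refl
Gap-irrelevant _ (_ ∷ _) g g′ = ℤP.<-irrelevant g g′

WF-irrelevant : ∀ bs (w w′ : WF bs) → w ≡ w′
WF-irrelevant [] tt tt = refl
WF-irrelevant ((a , T) ∷ bs) (p , g , w) (p′ , g′ , w′) = cong₂ _,_ (ℕP.<-irrelevant p p′)
  (cong₂ _,_ (Gap-irrelevant (a , T) bs g g′) (WF-irrelevant bs w w′))

blocks-injective : ∀ F G → blocks F ≡ blocks G → F ≡ G
blocks-injective (bs , w) (.bs , w′) refl = cong (bs ,_) (WF-irrelevant bs w w′)

FinSupp-resp : ∀ {u v : ℤ → ℕ} → (∀ i → u i ≡ v i) → FinSupp v → FinSupp u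
FinSupp-resp u≗v (N , vanish) = N , λ i N<∣i∣ → trans (u≗v i) (vanish i N<∣i∣)

c-finiteSupport : ∀ F → FinSupp (c F)
c-finiteSupport F =
  FinSupp-resp (c-chain F b (proj₁ S) (proj₂ S)) (vecFrom-finiteSupport b (layout (proj₁ S)))
  where
  b = firstStart (blocks F)
  S = chainBelow F ℤP.≤-refl

c-injective : ∀ F G → (∀ i → c F i ≡ c G i) → F ≡ G
c-injective F G c≗ = blocks-injective F G (begin
  blocks F                   ≡⟨ proj₂ SF ⟨
  chainBlocks b (proj₁ SF)   ≡⟨ chainBlocks-resp-layout b (proj₁ SF) (proj₁ SG)
                                  (vecFrom-injective-upToZeros b (layout (proj₁ SF)) (layout (proj₁ SG)) same-vecFrom) ⟩
  chainBlocks b (proj₁ SG)   ≡⟨ proj₂ SG ⟩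
  blocks G                   ∎)
  where
  open ≡-Reasoning
  b = firstStart (blocks F) ⊓ firstStart (blocks G)
  SF = chainBelow F (ℤP.i⊓j≤i _ _)
  SG = chainBelow G (ℤP.i⊓j≤j _ _)
  same-vecFrom : ∀ i → vecFrom b (layout (proj₁ SF)) i ≡ vecFrom b (layout (proj₁ SG)) i
  same-vecFrom i = trans (sym (c-chain F b (proj₁ SF) (proj₂ SF) i)) (trans (c≗ i) (c-chain G b (proj₁ SG) (proj₂ SG) i))

-[1+N]⊕2[N+1] : ∀ N → -[1+ N ] ⊕ (suc N ℕ.+ suc N) ≡ + suc N
-[1+N]⊕2[N+1] N = trans (ℤP.⊖-≥ (ℕP.m≤n+m (suc N) (suc N))) (cong +_ (ℕP.m+n∸n≡m (suc N) (suc N)))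

c-surjective : ∀ (v : NVec) → ∃ λ F → ∀ i → c F i ≡ proj₁ v i
c-surjective (v , N , vanish) = forestOf b (fromList W) , λ i → begin
  c (forestOf b (fromList W)) i      ≡⟨ c-chain (forestOf b (fromList W)) b (fromList W) refl i ⟩
  vecFrom b (layout (fromList W)) i  ≡⟨ cong (λ xs → vecFrom b xs i) (proj₂ (layout-fromList W)) ⟩
  vecFrom b (W ++ zeros _) i         ≡⟨ vecFrom-++-zeros b W _ i ⟩
  vecFrom b W i                      ≡⟨ vecFrom-window v b n i (below i) (above i) ⟩
  v i                                ∎
  where
  open ≡-Reasoning
  b = -[1+ N ]
  n = suc N ℕ.+ suc N
  W = window v b n
  below : ∀ i → i ℤ.< b → v i ≡ 0
  below -[1+ m ] (ℤ.-<- N<m) = vanish -[1+ m ] (ℕP.<-trans N<m (ℕP.n<1+n m))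
  above : ∀ i → b ⊕ n ℤ.≤ i → v i ≡ 0
  above i p with subst (ℤ._≤ i) (-[1+N]⊕2[N+1] N) p
  ... | ℤ.+≤+ N<i = vanish i N<i

ρs-start : ∀ a l r → 0 ℕ.< occurrences (ρs a (node l r)) a
ρs-start a l r rewrite occurrences-∷ (ρroot a l r) (ρs a l ++ ρs (a ⊕ suc (size l)) r) a
                     | ρroot≡start a l r | δ-refl a = s≤s z≤n

ρs-support : ∀ a T {i} → 0 ℕ.< occurrences (ρs a T) i → (a ℤ.≤ i) × (i ℤ.< a ⊕ size T)
ρs-support a T {i} pos = subst (λ n → (a ℤ.≤ i) × (i ℤ.< a ⊕ n)) (length-profile T)
  (vecFrom-support a (profile T) (subst (0 ℕ.<_) (occurrences-ρs a T i) pos))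

c-pos⇒∈supp : ∀ bs (w : WF bs) i → 0 ℕ.< c (bs , w) i → i ∈supp (bs , w)
c-pos⇒∈supp ((a , T) ∷ bs) (_ , _ , w) i pos
  with occurrences (ρs a T) i in eq | subst (0 ℕ.<_) (occurrences-++ (ρs a T) (ρsForest (bs , w)) i) pos
... | zero | pos′ = there (c-pos⇒∈supp bs w i pos′)
... | suc _ | _ = here (ρs-support a T (subst (0 ℕ.<_) (sym eq) (s≤s z≤n)))

∈supp⇒c-pos-below : ∀ bs (w : WF bs) i → i ∈supp (bs , w) → ∃ λ a → (a ℤ.≤ i) × (0 ℕ.< c (bs , w) a)
∈supp⇒c-pos-below ((a , leaf) ∷ bs) (() , _) i (here _)
∈supp⇒c-pos-below ((a , node l r) ∷ bs) (_ , _ , w) i (here (a≤i , _)) = a , a≤i ,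
  subst (0 ℕ.<_) (sym (occurrences-++ (ρs a (node l r)) (ρsForest (bs , w)) a))
    (ℕP.<-≤-trans (ρs-start a l r) (ℕP.m≤m+n _ _))
∈supp⇒c-pos-below ((a , T) ∷ bs) (_ , _ , w) i (there i∈bs) with ∈supp⇒c-pos-below bs w i i∈bs
... | a′ , a′≤i , pos = a′ , a′≤i ,
  subst (0 ℕ.<_) (sym (occurrences-++ (ρs a T) (ρsForest (bs , w)) a′)) (ℕP.<-≤-trans pos (ℕP.m≤n+m _ _))

c-supportPositive : ∀ F → ForestSuppPos F ⇔ VecSuppPos (c F)
c-supportPositive (bs , w) = mk⇔
  (λ forestPos i pos → forestPos i (c-pos⇒∈supp bs w i pos))
  (λ vecPos i i∈F → let a , a≤i , pos = ∈supp⇒c-pos-below bs w i i∈F in ℤP.≤-trans (vecPos a pos) a≤i)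

proposition3p3 :
    (∀ (F : IndexedForest) → FinSupp (c F))
    × (∀ (F G : IndexedForest) → (∀ i → c F i ≡ c G i) → F ≡ G)
    × (∀ (v : NVec) → ∃ λ (F : IndexedForest) → ∀ i → c F i ≡ proj₁ v i)
    × (∀ (F : IndexedForest) → ForestSuppPos F ⇔ VecSuppPos (c F))
proposition3p3 = c-finiteSupport , c-injective , c-surjective , c-supportPositive
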